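{- Let $p=12$. Suppose $v$ is a cube-free word over $\mathbb{N}$ and $a\in\mathbb{N}$ is a letter such that $va\in\widetilde{\mathcal{C}}^{(p)}$ and $va=uyyy$ for some non-empty words $u,y$. Then $\Gamma(va)=\Gamma(yy)=\Gamma(uyy)$.
   Context: Words are finite sequences of letters from $\mathbb{N}$; $\varepsilon$ is the empty word. A cube is a word $uuu$ with $u$ nonempty; its period is $|u|$; a word is cube-free if it has no cube as a factor. $\widetilde{\mathcal{C}}^{(p)}$ is the set of words over $\mathbb{N}$ containing no factor $uuu$ with $1\le|u|\le p$. A minimal cube is a cube that contains no other cube as a proper factor. A word is normalized if it is lexicographically smallest among all words obtained from it by applying a permutation of $\mathbb{N}$ letterwise. $\Gamma$ denotes the set of normalized proper prefixes (including $\varepsilon$) of minimal cubes of period at most $p$. For any word $w$, $\Gamma(w)$ denotes the longest element of $\Gamma$ that equals the image, under some permutation of $\mathbb{N}$ applied letterwise, of a suffix of $w$. -}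

module Defs where

open import Data.Nat using (ℕ; _<_; _≤_; _+_; _*_)
open import Data.List using (List; []; _∷_; _++_; length; map)
open import Data.Product using (Σ; ∃; ∃-syntax; _×_; _,_)
open import Relation.Binary.PropositionalEquality using (_≡_)
open import Relation.Nullary using (¬_)
open import Function.Bundles using (_↔_; Inverse)

Word : Set
Word = List ℕ

Perm : Set
Perm = ℕ ↔ ℕ

applyPerm : Perm → Word → Word
applyPerm π w = map (Inverse.to π) w

data _≤lex_ : Word → Word → Set where
  []≤  : ∀ {ys} → [] ≤lex ys
  <∷   : ∀ {x y xs ys} → x < y → (x ∷ xs) ≤lex (y ∷ ys)
  ≡∷   : ∀ {x xs ys} → xs ≤lex ys → (x ∷ xs) ≤lex (x ∷ ys)

Normalized : Word → Set
Normalized w = ∀ (π : Perm) → w ≤lex applyPerm π w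

NonEmpty : Word → Set
NonEmpty w = 1 ≤ length w

Factor : Word → Word → Set
Factor f w = ∃[ l ] ∃[ r ] (w ≡ l ++ f ++ r)

ProperFactor : Word → Word → Set
ProperFactor f w = Factor f w × length f < length w

IsCubeWithPeriod : Word → ℕ → Set
IsCubeWithPeriod c n = ∃[ x ] (NonEmpty x × length x ≡ n × c ≡ x ++ x ++ x)

IsCube : Word → Set
IsCube c = ∃[ x ] (NonEmpty x × c ≡ x ++ x ++ x)

CubeFree : Word → Set
CubeFree w = ∀ x → NonEmpty x → ¬ Factor (x ++ x ++ x) w

InCtilde : ℕ → Word → Set
InCtilde p w = ∀ x → NonEmpty x → length x ≤ p → ¬ Factor (x ++ x ++ x) w

MinimalCube : Word → Set
MinimalCube c = IsCube c × (∀ d → ProperFactor d c → ¬ IsCube d)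

ProperPrefix : Word → Word → Set
ProperPrefix g c = ∃[ s ] (NonEmpty s × c ≡ g ++ s)

InΓ : ℕ → Word → Set
InΓ p g = Normalized g × (∃[ c ] ∃[ n ] (MinimalCube c × IsCubeWithPeriod c n × n ≤ p × ProperPrefix g c))

Suffix : Word → Word → Set
Suffix s w = ∃[ l ] (w ≡ l ++ s)

MatchesSuffix : Word → Word → Set
MatchesSuffix g w = ∃[ π ] ∃[ s ] (Suffix s w × g ≡ applyPerm π s)

IsΓof : ℕ → Word → Word → Set
IsΓof p w g = InΓ p g × MatchesSuffix g w
              × (∀ g' → InΓ p g' → MatchesSuffix g' w → length g' ≤ length g)

module Submission where

open import Defs
open import Data.Nat using (ℕ; zero; suc; _+_; _∸_; _≤_; _<_; z≤n; s≤s; _≟_; _≤?_; _<?_)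
open import Data.Nat.Properties
open import Data.Nat.ListAction using (sum)
open import Data.List using (List; []; _∷_; _∷ʳ_; _++_; length; take; drop; map)
open import Data.List.Properties
  using (length-++; ++-assoc; ++-identityʳ; ++-conicalʳ; ∷-injective; ∷-injectiveˡ; ∷ʳ-++; map-++; map-∘; map-cong;
         map-id; length-map; length-take; length-drop; take++drop≡id; drop-all; ≡-dec)
open import Data.List.Membership.Propositional using (_∈_; _∉_)
open import Data.List.Membership.Propositional.Properties using (∈-++⁻; ∈-∃++)
open import Data.List.Membership.DecPropositional _≟_ using (_∈?_)
open import Data.List.Relation.Unary.Any using (here; there)
open import Data.List.Relation.Binary.Infix.Heterogeneous using (Infix; View; MkView; toView; fromView)
open import Data.List.Relation.Binary.Infix.Heterogeneous.Properties using (infix?)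
open import Data.List.Relation.Binary.Pointwise using (Pointwise-≡⇒≡; ≡⇒Pointwise-≡)
open import Data.Maybe using (Maybe; just; nothing)
open import Data.Product using (∃; ∃-syntax; _×_; _,_; proj₁; proj₂)
open import Data.Sum using (_⊎_; inj₁; inj₂; [_,_])
open import Data.Empty using (⊥-elim)
open import Function using (_∘_; _∘′_)
open import Function.Bundles using (Inverse; Injection; mk↔ₛ′)
open import Function.Properties.Inverse using (↔⇒↣)
open import Function.Construct.Composition using (_↔-∘_)
open import Function.Construct.Identity using (↔-id)
open import Function.Construct.Symmetry using (↔-sym)
open import Relation.Nullary using (¬_; Dec; yes; no; map′; _×-dec_; _⊎-dec_; ¬?)
open import Relation.Unary using (Pred; Decidable)
open import Relation.Binary.PropositionalEquality hiding ([_])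

-- Since va contains yyy and has no cube of period ≤ 12, we get |y| > 12 and yyy has no
-- cube of period ≤ 12 either.  Γ(w) exists for every w because, up to renaming letters,
-- "s is a proper prefix of a minimal cube xxx with |x| ≤ p" is decidable: either
-- x = take |x| s, or s is cube-free and shorter than p, and then x = s M with a fresh
-- letter M works.  Finally no suffix of X yy longer than yy matches an element of Γ:
-- such a suffix is a prefix of a cube of period n ≤ 12 < |y|, so yy has period n, hence
-- so has yyy, which therefore begins with a cube of period n.  So Γ(X yy) = Γ(yy) for
-- X = u and X = uy.

cube : Word → Word
cube x = x ++ x ++ x

cube-++ : ∀ t r → cube t ++ r ≡ t ++ t ++ t ++ r
cube-++ t r = trans (++-assoc t (t ++ t) r) (cong (t ++_) (++-assoc t t r))

length-cube : ∀ x → length (cube x) ≡ length x + (length x + length x)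
length-cube x = trans (length-++ x) (cong (length x +_) (length-++ x))

length-cube-< : ∀ t x → length t < length x → length (cube t) < length (cube x)
length-cube-< t x t<x =
  subst₂ _<_ (sym (length-cube t)) (sym (length-cube x)) (+-mono-< t<x (+-mono-< t<x t<x))

length-cube-<⁻ : ∀ t x → length (cube t) < length (cube x) → length t < length x
length-cube-<⁻ t x 3t<3x with length t <? length x
... | yes t<x = t<x
... | no  t≮x = ⊥-elim (<⇒≱ 3t<3x
  (subst₂ _≤_ (sym (length-cube x)) (sym (length-cube t)) (+-mono-≤ x≤t (+-mono-≤ x≤t x≤t))))
  where x≤t = ≮⇒≥ t≮x

map-cube : ∀ (φ : ℕ → ℕ) x → map φ (cube x) ≡ cube (map φ x)
map-cube φ x = trans (map-++ φ x (x ++ x)) (cong (map φ x ++_) (map-++ φ x x))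

length-∷ʳ : ∀ (s : Word) c → length (s ∷ʳ c) ≡ suc (length s)
length-∷ʳ s c = trans (length-++ s) (+-comm (length s) 1)

take-length-++ : ∀ (u v : Word) → take (length u) (u ++ v) ≡ u
take-length-++ []      v = refl
take-length-++ (c ∷ u) v = cong (c ∷_) (take-length-++ u v)

drop-length-++ : ∀ (u v : Word) → drop (length u) (u ++ v) ≡ v
drop-length-++ []      v = refl
drop-length-++ (c ∷ u) v = drop-length-++ u v

take-++-≤ : ∀ {n} (u v : Word) → n ≤ length u → take n (u ++ v) ≡ take n u
take-++-≤ {zero}  u       v _          = refl
take-++-≤ {suc n} (c ∷ u) v (s≤s n≤u) = cong (c ∷_) (take-++-≤ u v n≤u)

length-take-≤ : ∀ {n} (w : Word) → n ≤ length w → length (take n w) ≡ n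
length-take-≤ {n} w n≤w = trans (length-take n w) (m≤n⇒m⊓n≡m n≤w)

Factor-++ˡ : ∀ {f w} l → Factor f w → Factor f (l ++ w)
Factor-++ˡ {f} l (l′ , r , refl) = l ++ l′ , r , sym (++-assoc l l′ (f ++ r))

Factor-trans : ∀ {f g w} → Factor f g → Factor g w → Factor f w
Factor-trans {f} (l₁ , r₁ , refl) (l₂ , r₂ , refl) = l₂ ++ l₁ , r₁ ++ r₂ , (begin
  l₂ ++ (l₁ ++ f ++ r₁) ++ r₂   ≡⟨ cong (l₂ ++_) (++-assoc l₁ (f ++ r₁) r₂) ⟩
  l₂ ++ l₁ ++ (f ++ r₁) ++ r₂   ≡⟨ cong (λ z → l₂ ++ l₁ ++ z) (++-assoc f r₁ r₂) ⟩
  l₂ ++ l₁ ++ f ++ r₁ ++ r₂     ≡⟨ ++-assoc l₂ l₁ _ ⟨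
  (l₂ ++ l₁) ++ f ++ r₁ ++ r₂   ∎)
  where open ≡-Reasoning

Factor-map : ∀ (φ : ℕ → ℕ) {f w} → Factor f w → Factor (map φ f) (map φ w)
Factor-map φ {f} (l , r , refl) =
  map φ l , map φ r , trans (map-++ φ l (f ++ r)) (cong (map φ l ++_) (map-++ φ f r))

length-Factor : ∀ {f w} → Factor f w → length f ≤ length w
length-Factor {f} (l , r , refl) =
  subst (length f ≤_) (sym (trans (length-++ l) (cong (length l +_) (length-++ f))))
    (≤-trans (m≤m+n (length f) (length r)) (m≤n+m _ (length l)))

length-≤-cube : ∀ t → length t ≤ length (cube t)
length-≤-cube t = length-Factor {t} ([] , t ++ t , refl)

private
  View⇒Factor : ∀ {f w} → View _≡_ f w → Factor f w
  View⇒Factor (MkView l pw r) = l , r , cong (λ z → l ++ z ++ r) (sym (Pointwise-≡⇒≡ pw))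

  Factor⇒Infix : ∀ {f w} → Factor f w → Infix _≡_ f w
  Factor⇒Infix (l , r , refl) = fromView (MkView l (≡⇒Pointwise-≡ refl) r)

factor? : ∀ f w → Dec (Factor f w)
factor? f w = map′ (View⇒Factor ∘′ toView) Factor⇒Infix (infix? _≟_ f w)

properPrefix? : ∀ g c → Dec (ProperPrefix g c)
properPrefix? g c = map′ found search (≡-dec _≟_ c (g ++ r) ×-dec (1 ≤? length r))
  where
  r = drop (length g) c
  found : c ≡ g ++ r × NonEmpty r → ProperPrefix g c
  found (c≡ , r≢ε) = r , r≢ε , c≡
  search : ProperPrefix g c → c ≡ g ++ r × NonEmpty r
  search (r′ , r′≢ε , refl) rewrite drop-length-++ g r′ = refl , r′≢ε

Suffix-of-shorter : ∀ (l l′ u v : Word) → l ++ u ≡ l′ ++ v → length v ≤ length u → Suffix v u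
Suffix-of-shorter []      l′        u v eq   _   = l′ , eq
Suffix-of-shorter (c ∷ l) []        u v refl v≤u =
  ⊥-elim (<⇒≱ (s≤s (subst (length u ≤_) (sym (length-++ l)) (m≤n+m _ _))) v≤u)
Suffix-of-shorter (c ∷ l) (c′ ∷ l′) u v eq   v≤u = Suffix-of-shorter l l′ u v (proj₂ (∷-injective eq)) v≤u

-- Minimal cubes

CubeFactorBelow : ℕ → Word → Set
CubeFactorBelow n w = ∃[ t ] (NonEmpty t × length t < n × Factor (cube t) w)

cubeFactorBelow? : ∀ n w → Dec (CubeFactorBelow n w)
cubeFactorBelow? n w = map′ found search (anyUpTo? (λ i → anyUpTo? (candidate? i) n) (suc (length w)))
  where
  candidate : ℕ → ℕ → Set
  candidate i j = NonEmpty (take j (drop i w)) × Factor (cube (take j (drop i w))) w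
  candidate? : ∀ i j → Dec (candidate i j)
  candidate? i j = (1 ≤? length (take j (drop i w))) ×-dec factor? _ w
  found : (∃ λ i → i < suc (length w) × ∃ λ j → j < n × candidate i j) → CubeFactorBelow n w
  found (i , _ , j , j<n , t≢ε , fac) =
    take j (drop i w) , t≢ε , ≤-<-trans (≤-trans (≤-reflexive (length-take j (drop i w))) (m⊓n≤m j _)) j<n , fac
  search : CubeFactorBelow n w → ∃ λ i → i < suc (length w) × ∃ λ j → j < n × candidate i j
  search (t , t≢ε , t<n , fac@(l , r , w≡)) =
    length l , s≤s (length-Factor {l} ([] , cube t ++ r , w≡)) , length t , t<n ,
    subst NonEmpty (sym t≡) t≢ε , subst (λ z → Factor (cube z) w) (sym t≡) fac
    where
    t≡ : take (length t) (drop (length l) w) ≡ t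
    t≡ = begin
      take (length t) (drop (length l) w)                  ≡⟨ cong (λ z → take (length t) (drop (length l) z)) w≡ ⟩
      take (length t) (drop (length l) (l ++ cube t ++ r)) ≡⟨ cong (take (length t)) (drop-length-++ l _) ⟩
      take (length t) (cube t ++ r)                        ≡⟨ cong (take (length t)) (cube-++ t r) ⟩
      take (length t) (t ++ t ++ t ++ r)                   ≡⟨ take-length-++ t _ ⟩
      t                                                    ∎
      where open ≡-Reasoning

minimalCube⇒¬cubeFactorBelow : ∀ x → MinimalCube (cube x) → ¬ CubeFactorBelow (length x) (cube x)
minimalCube⇒¬cubeFactorBelow x (_ , minimal) (t , t≢ε , t<x , fac) =
  minimal (cube t) (fac , length-cube-< t x t<x) (t , t≢ε , refl)

¬cubeFactorBelow⇒minimalCube : ∀ x → NonEmpty x → ¬ CubeFactorBelow (length x) (cube x) → MinimalCube (cube x)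
¬cubeFactorBelow⇒minimalCube x x≢ε noCube = (x , x≢ε , refl) ,
  λ { d (fac , d<c) (t , t≢ε , refl) → noCube (t , t≢ε , length-cube-<⁻ t x d<c , fac) }

minimalCube? : ∀ x → NonEmpty x → Dec (MinimalCube (cube x))
minimalCube? x x≢ε = map′ (¬cubeFactorBelow⇒minimalCube x x≢ε) (minimalCube⇒¬cubeFactorBelow x)
  (¬? (cubeFactorBelow? (length x) (cube x)))

NonEmpty-map : ∀ (φ : ℕ → ℕ) w → NonEmpty w → NonEmpty (map φ w)
NonEmpty-map φ w = subst (1 ≤_) (sym (length-map φ w))

IsCube-map : ∀ (φ : ℕ → ℕ) {c} → IsCube c → IsCube (map φ c)
IsCube-map φ (x , x≢ε , refl) = map φ x , NonEmpty-map φ x x≢ε , map-cube φ x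

applyPerm-inverseˡ : ∀ π w → applyPerm (↔-sym π) (applyPerm π w) ≡ w
applyPerm-inverseˡ π w = trans (sym (map-∘ w)) (trans (map-cong (Inverse.strictlyInverseʳ π) w) (map-id w))

MinimalCube-applyPerm : ∀ π {c} → MinimalCube c → MinimalCube (applyPerm π c)
MinimalCube-applyPerm π {c} (isCube , minimal) = IsCube-map (Inverse.to π) isCube ,
  λ d (fac , d<c) isCube-d → minimal (applyPerm (↔-sym π) d)
    (subst (Factor _) (applyPerm-inverseˡ π c) (Factor-map (Inverse.from π) fac) ,
     subst₂ _<_ (sym (length-map _ d)) (length-map _ c) d<c)
    (IsCube-map (Inverse.from π) isCube-d)

prefix-avoiding : ∀ {M} (f : Word) {r} (A : Word) {B} → M ∉ f → f ++ r ≡ A ++ M ∷ B → ∃[ r′ ] A ≡ f ++ r′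
prefix-avoiding []      A       _   _  = A , refl
prefix-avoiding (c ∷ f) []      M∉f eq = ⊥-elim (M∉f (here (sym (∷-injectiveˡ eq))))
prefix-avoiding (c ∷ f) (a ∷ A) M∉f eq with ∷-injective eq
... | refl , eq′ with prefix-avoiding f A (M∉f ∘ there) eq′
... | r′ , refl = r′ , refl

Factor-avoiding : ∀ {M} {f : Word} (A : Word) {B} → M ∉ f → Factor f (A ++ M ∷ B) → Factor f A ⊎ Factor f B
Factor-avoiding A       M∉f ([] , r , eq) with prefix-avoiding _ A M∉f (sym eq)
... | r′ , A≡ = inj₁ ([] , r′ , A≡)
Factor-avoiding []      M∉f (c ∷ l , r , refl) = inj₂ (l , r , refl)
Factor-avoiding (a ∷ A) M∉f (c ∷ l , r , eq) with ∷-injective eq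
... | refl , eq′ with Factor-avoiding A M∉f (l , r , eq′)
... | inj₁ (l′ , r′ , refl) = inj₁ (a ∷ l′ , r′ , refl)
... | inj₂ fac              = inj₂ fac

first-occurrence : ∀ {M} (A : Word) {B} (C : Word) {D} → M ∉ A → A ++ M ∷ B ≡ C ++ M ∷ D →
  (C ≡ A × D ≡ B) ⊎ ∃[ C′ ] (C ≡ A ++ M ∷ C′ × B ≡ C′ ++ M ∷ D)
first-occurrence []      []      _   refl = inj₁ (refl , refl)
first-occurrence []      (c ∷ C) _   refl = inj₂ (C , refl , refl)
first-occurrence (a ∷ A) []      M∉A refl = ⊥-elim (M∉A (here refl))
first-occurrence (a ∷ A) (c ∷ C) M∉A eq with ∷-injective eq
... | refl , eq′ with first-occurrence A C (M∉A ∘ there) eq′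
... | inj₁ (refl , refl)      = inj₁ (refl , refl)
... | inj₂ (C′ , refl , refl) = inj₂ (C′ , refl , refl)

square-rotation-factor : ∀ t₁ M t₂ → Factor (M ∷ (t₂ ++ t₁) ∷ʳ M) ((t₁ ++ M ∷ t₂) ++ t₁ ++ M ∷ t₂)
square-rotation-factor t₁ M t₂ = t₁ , t₂ , (begin
  (t₁ ++ M ∷ t₂) ++ t₁ ++ M ∷ t₂       ≡⟨ ++-assoc t₁ (M ∷ t₂) _ ⟩
  t₁ ++ M ∷ (t₂ ++ t₁ ++ M ∷ t₂)       ≡⟨ cong (λ z → t₁ ++ M ∷ z) (++-assoc t₂ t₁ _) ⟨
  t₁ ++ M ∷ ((t₂ ++ t₁) ++ M ∷ t₂)     ≡⟨ cong (λ z → t₁ ++ M ∷ z) (∷ʳ-++ (t₂ ++ t₁) M t₂) ⟨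
  t₁ ++ M ∷ ((t₂ ++ t₁) ∷ʳ M ++ t₂)    ∎)
  where open ≡-Reasoning

-- A cube factor of (s M)³ avoiding M lies inside a copy of s; one containing M contains two
-- consecutive occurrences of M, and these are |s| + 1 apart.
module _ (s : Word) (M : ℕ) (M∉s : M ∉ s) where

  private
    blocks : ℕ → Word
    blocks zero    = []
    blocks (suc k) = s ++ M ∷ blocks k

    cube≡blocks : cube (s ∷ʳ M) ≡ blocks 3
    cube≡blocks = trans (∷ʳ-++ s M _) (cong (λ z → s ++ M ∷ z) (∷ʳ-++ s M _))

    Factor-blocks-avoiding : ∀ k {f} → NonEmpty f → M ∉ f → Factor f (blocks k) → Factor f s
    Factor-blocks-avoiding zero    f≢ε _   fac = ⊥-elim (<⇒≱ f≢ε (length-Factor fac))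
    Factor-blocks-avoiding (suc k) f≢ε M∉f fac with Factor-avoiding s M∉f fac
    ... | inj₁ fac-s = fac-s
    ... | inj₂ fac-k = Factor-blocks-avoiding k f≢ε M∉f fac-k

    gap-between-occurrences : ∀ k {z} → Factor (M ∷ z ∷ʳ M) (blocks k) → length s ≤ length z
    gap-between-occurrences zero fac = ⊥-elim (<⇒≱ (s≤s z≤n) (length-Factor fac))
    gap-between-occurrences (suc k) {z} (l , r , eq)
      with first-occurrence s l M∉s (trans eq (cong (λ w → l ++ M ∷ w) (∷ʳ-++ z M r)))
    ... | inj₂ (l′ , refl , eq′) =
      gap-between-occurrences k (l′ , r , trans eq′ (cong (λ w → l′ ++ M ∷ w) (sym (∷ʳ-++ z M r))))
    gap-between-occurrences (suc zero) {z} (l , r , eq) | inj₁ (_ , eq′)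
      with () ← ++-conicalʳ z (M ∷ r) eq′
    gap-between-occurrences (suc (suc k)) (l , r , eq) | inj₁ (_ , eq′)
      with first-occurrence s _ M∉s (sym eq′)
    ... | inj₁ (refl , _)      = ≤-refl
    ... | inj₂ (z′ , refl , _) = subst (length s ≤_) (sym (length-++ s)) (m≤m+n (length s) _)

  minimalCube-∷ʳ-fresh : CubeFree s → MinimalCube (cube (s ∷ʳ M))
  minimalCube-∷ʳ-fresh cubeFree = ¬cubeFactorBelow⇒minimalCube x x≢ε noShortCube
    where
    x = s ∷ʳ M
    x≢ε : NonEmpty x
    x≢ε = subst (1 ≤_) (sym (length-∷ʳ s M)) (s≤s z≤n)
    noShortCube : ¬ CubeFactorBelow (length x) (cube x)
    noShortCube (t , t≢ε , t<x , fac) with M ∈? t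
    ... | no M∉t = cubeFree t t≢ε
                     (Factor-blocks-avoiding 3 (≤-trans t≢ε (length-≤-cube t)) M∉cube (subst (Factor _) cube≡blocks fac))
      where
      M∉cube : M ∉ cube t
      M∉cube M∈ = [ M∉t , [ M∉t , M∉t ] ∘ ∈-++⁻ t ] (∈-++⁻ t M∈)
    ... | yes M∈t with ∈-∃++ M∈t
    ... | t₁ , t₂ , refl = <⇒≱ t<x (subst₂ _≤_ (sym (length-∷ʳ s M)) (sym ∣t∣) (s≤s gap))
      where
      ∣t∣ : length (t₁ ++ M ∷ t₂) ≡ suc (length (t₂ ++ t₁))
      ∣t∣ = trans (length-++ t₁) (trans (+-suc (length t₁) (length t₂))
              (cong suc (trans (+-comm (length t₁) _) (sym (length-++ t₂)))))
      gap : length s ≤ length (t₂ ++ t₁)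
      gap = gap-between-occurrences 3 (subst (Factor _) cube≡blocks
              (Factor-trans (Factor-++ˡ (t₁ ++ M ∷ t₂) (square-rotation-factor t₁ M t₂)) fac))

∈⇒≤sum : ∀ {m} {ns : List ℕ} → m ∈ ns → m ≤ sum ns
∈⇒≤sum               (here refl) = m≤m+n _ _
∈⇒≤sum {ns = n ∷ ns} (there m∈)  = ≤-trans (∈⇒≤sum m∈) (m≤n+m _ n)

1+sum∉ : ∀ (ns : List ℕ) → suc (sum ns) ∉ ns
1+sum∉ ns = 1+n≰n ∘ ∈⇒≤sum

-- Prefixes of short minimal cubes

-- InΓ p g unfolds to Normalized g × MinimalCubePrefix p g.
MinimalCubePrefix : ℕ → Word → Set
MinimalCubePrefix p g = ∃[ c ] ∃[ n ] (MinimalCube c × IsCubeWithPeriod c n × n ≤ p × ProperPrefix g c)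

MinimalCubeRoot : ℕ → Word → Word → Set
MinimalCubeRoot p s x = NonEmpty x × length x ≤ p × MinimalCube (cube x) × ProperPrefix s (cube x)

root⇒MinimalCubePrefix : ∀ {p s} x → MinimalCubeRoot p s x → MinimalCubePrefix p s
root⇒MinimalCubePrefix x (x≢ε , x≤p , minimal , prefix) =
  cube x , length x , minimal , (x , x≢ε , refl , refl) , x≤p , prefix

MinimalCubePrefix⇒root : ∀ {p s} → MinimalCubePrefix p s → ∃ (MinimalCubeRoot p s)
MinimalCubePrefix⇒root (_ , _ , minimal , (x , x≢ε , refl , refl) , x≤p , prefix) =
  x , x≢ε , x≤p , minimal , prefix

minimalCubeRoot? : ∀ p s x → Dec (MinimalCubeRoot p s x)
minimalCubeRoot? p s x with 1 ≤? length x
... | no  x≡ε = no (x≡ε ∘ proj₁)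
... | yes x≢ε = map′ (x≢ε ,_) proj₂ (length x ≤? p ×-dec minimalCube? x x≢ε ×-dec properPrefix? s (cube x))

shortCubeFree⇒MinimalCubePrefix : ∀ {p s} → length s < p → CubeFree s → MinimalCubePrefix p s
shortCubeFree⇒MinimalCubePrefix {p} {s} s<p cubeFree = root⇒MinimalCubePrefix (s ∷ʳ M)
  (subst (1 ≤_) (sym (length-∷ʳ s M)) (s≤s z≤n) , subst (_≤ p) (sym (length-∷ʳ s M)) s<p ,
   minimalCube-∷ʳ-fresh s M (1+sum∉ s) cubeFree , M ∷ (s ∷ʳ M) ++ (s ∷ʳ M) , s≤s z≤n , ∷ʳ-++ s M _)
  where M = suc (sum s)

minimalCubePrefix-[] : ∀ {p} → 1 ≤ p → MinimalCubePrefix p []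
minimalCubePrefix-[] 1≤p = shortCubeFree⇒MinimalCubePrefix 1≤p
  (λ t t≢ε fac → <⇒≱ (≤-trans t≢ε (length-≤-cube t)) (length-Factor fac))

module _ {p : ℕ} {s : Word} where

  -- The root x either fits inside s, and then x = take |x| s, or is longer than s, and
  -- then s is cube-free; conversely a cube-free s shorter than p is a prefix of (s M)³.
  private
    RootWithinPrefix FreshRoot : Set
    RootWithinPrefix = ∃ λ j → j < suc p × MinimalCubeRoot p s (take j s)
    FreshRoot        = length s < p × ¬ CubeFactorBelow (suc (length s)) s

    cases⇒MinimalCubePrefix : RootWithinPrefix ⊎ FreshRoot → MinimalCubePrefix p s
    cases⇒MinimalCubePrefix (inj₁ (j , _ , root))  = root⇒MinimalCubePrefix (take j s) root
    cases⇒MinimalCubePrefix (inj₂ (s<p , noCube)) = shortCubeFree⇒MinimalCubePrefix s<p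
      (λ t t≢ε fac → noCube (t , t≢ε , s≤s (≤-trans (length-≤-cube t) (length-Factor fac)) , fac))

    MinimalCubePrefix⇒cases : MinimalCubePrefix p s → RootWithinPrefix ⊎ FreshRoot
    MinimalCubePrefix⇒cases prefix with MinimalCubePrefix⇒root prefix
    ... | x , root@(x≢ε , x≤p , minimal , r , _ , cube≡) with length x ≤? length s
    ...   | yes x≤s = inj₁ (length x , s≤s x≤p , subst (MinimalCubeRoot p s) (sym take≡x) root)
      where
      take≡x : take (length x) s ≡ x
      take≡x = trans (sym (take-++-≤ s r x≤s)) (trans (cong (take (length x)) (sym cube≡)) (take-length-++ x (x ++ x)))
    ...   | no  x≰s = inj₂ (<-≤-trans s<x x≤p , λ (t , t≢ε , t≤s , fac) →
                minimalCube⇒¬cubeFactorBelow x minimal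
                  (t , t≢ε , <-≤-trans t≤s s<x , Factor-trans fac ([] , r , cube≡)))
      where s<x = ≰⇒> x≰s

  minimalCubePrefix? : Dec (MinimalCubePrefix p s)
  minimalCubePrefix? = map′ cases⇒MinimalCubePrefix MinimalCubePrefix⇒cases
    (anyUpTo? (λ j → minimalCubeRoot? p s (take j s)) (suc p)
     ⊎-dec ((length s <? p) ×-dec ¬? (cubeFactorBelow? (suc (length s)) s)))

MinimalCubePrefix-applyPerm : ∀ {p} π {s} → MinimalCubePrefix p s → MinimalCubePrefix p (applyPerm π s)
MinimalCubePrefix-applyPerm π {s} (_ , n , minimal , (x , x≢ε , ∣x∣ , refl) , n≤p , (r , r≢ε , cube≡)) =
  applyPerm π (cube x) , n , MinimalCube-applyPerm π minimal ,
  (applyPerm π x , NonEmpty-map _ x x≢ε , trans (length-map _ x) ∣x∣ , map-cube _ x) , n≤p ,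
  (applyPerm π r , NonEmpty-map _ r r≢ε , trans (cong (applyPerm π) cube≡) (map-++ _ s r))

MinimalCubePrefix-unapplyPerm : ∀ {p} π {s} → MinimalCubePrefix p (applyPerm π s) → MinimalCubePrefix p s
MinimalCubePrefix-unapplyPerm π {s} prefix =
  subst (MinimalCubePrefix _) (applyPerm-inverseˡ π s) (MinimalCubePrefix-applyPerm (↔-sym π) prefix)

-- Normal forms

swap : ℕ → ℕ → ℕ → ℕ
swap a b x with x ≟ a | x ≟ b
... | yes _ | _     = b
... | no _  | yes _ = a
... | no _  | no _  = x

swap-a : ∀ a b → swap a b a ≡ b
swap-a a b with a ≟ a
... | yes _  = refl
... | no a≢a = ⊥-elim (a≢a refl)

swap-b : ∀ a b → swap a b b ≡ a
swap-b a b with b ≟ a | b ≟ b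
... | yes b≡a | _      = b≡a
... | no _    | yes _  = refl
... | no _    | no b≢b = ⊥-elim (b≢b refl)

swap-other : ∀ a b {x} → x ≢ a → x ≢ b → swap a b x ≡ x
swap-other a b {x} x≢a x≢b with x ≟ a | x ≟ b
... | yes x≡a | _       = ⊥-elim (x≢a x≡a)
... | no _    | yes x≡b = ⊥-elim (x≢b x≡b)
... | no _    | no _    = refl

swap-involutive : ∀ a b x → swap a b (swap a b x) ≡ x
swap-involutive a b x with x ≟ a | x ≟ b
... | yes refl | _        = swap-b x b
... | no _     | yes refl = swap-a a x
... | no x≢a   | no x≢b   = swap-other a b x≢a x≢b

transpose : ℕ → ℕ → Perm
transpose a b = mk↔ₛ′ (swap a b) (swap a b) (swap-involutive a b) (swap-involutive a b)

-- Invariant: ρ maps the letters read so far onto 0, …, k − 1; the next unseen letter is sent to k.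
normalizer : ℕ → Perm → Word → Perm
normalizer k ρ []      = ρ
normalizer k ρ (c ∷ w) with Inverse.to ρ c <? k
... | yes _ = normalizer k ρ w
... | no  _ = normalizer (suc k) (transpose (Inverse.to ρ c) k ↔-∘ ρ) w

normalizer-fixes : ∀ k ρ w {x} → Inverse.to ρ x < k → Inverse.to (normalizer k ρ w) x ≡ Inverse.to ρ x
normalizer-fixes k ρ []      x<k = refl
normalizer-fixes k ρ (c ∷ w) {x} x<k with Inverse.to ρ c <? k
... | yes _   = normalizer-fixes k ρ w x<k
... | no c≮k = trans (normalizer-fixes (suc k) _ w (subst (_< suc k) (sym fixed) (m≤n⇒m≤1+n x<k))) fixed
  where
  fixed : swap (Inverse.to ρ c) k (Inverse.to ρ x) ≡ Inverse.to ρ x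
  fixed = swap-other _ k (λ x≡c → c≮k (subst (_< k) x≡c x<k)) (λ x≡k → <-irrefl x≡k x<k)

data Canonical : ℕ → Word → Set where
  []    : ∀ {k} → Canonical k []
  old   : ∀ {k c w} → c < k → Canonical k w → Canonical k (c ∷ w)
  fresh : ∀ {k w} → Canonical (suc k) w → Canonical k (k ∷ w)

canonical-normalizer : ∀ k ρ w → Canonical k (applyPerm (normalizer k ρ w) w)
canonical-normalizer k ρ []      = []
canonical-normalizer k ρ (c ∷ w) with Inverse.to ρ c <? k
... | yes c<k = subst (λ d → Canonical k (d ∷ _)) (sym (normalizer-fixes k ρ w c<k))
                  (old c<k (canonical-normalizer k ρ w))
... | no  _   = subst (λ d → Canonical k (d ∷ applyPerm (normalizer (suc k) ρ′ w) w))
                  (sym (trans (normalizer-fixes (suc k) ρ′ w c↦<1+k) c↦k))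
                  (fresh (canonical-normalizer (suc k) ρ′ w))
  where
  ρ′ = transpose (Inverse.to ρ c) k ↔-∘ ρ
  c↦k : Inverse.to ρ′ c ≡ k
  c↦k = swap-a (Inverse.to ρ c) k
  c↦<1+k : Inverse.to ρ′ c < suc k
  c↦<1+k = subst (_< suc k) (sym c↦k) ≤-refl

Canonical⇒≤lex : ∀ π {k w} → Canonical k w → (∀ {j} → j < k → Inverse.to π j ≡ j) → w ≤lex applyPerm π w
Canonical⇒≤lex π []                   fixes = []≤
Canonical⇒≤lex π (old {c = c} c<k cw) fixes rewrite fixes c<k = ≡∷ (Canonical⇒≤lex π cw fixes)
Canonical⇒≤lex π (fresh {k} cw)       fixes with Inverse.to π k ≟ k
... | yes k↦k = subst (λ d → _ ≤lex (d ∷ _)) (sym k↦k) (≡∷ (Canonical⇒≤lex π cw fixes′))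
  where
  fixes′ : ∀ {j} → j < suc k → Inverse.to π j ≡ j
  fixes′ (s≤s j≤k) with m≤n⇒m<n∨m≡n j≤k
  ... | inj₁ j<k  = fixes j<k
  ... | inj₂ refl = k↦k
... | no k↛k = <∷ (≤∧≢⇒< k≤πk (k↛k ∘ sym))
  where
  k≤πk : k ≤ Inverse.to π k
  k≤πk with Inverse.to π k <? k
  ... | no  πk≮k = ≮⇒≥ πk≮k
  ... | yes πk<k = ⊥-elim (k↛k (Injection.injective (↔⇒↣ π) (fixes πk<k)))

normalize : ∀ w → ∃ λ π → Normalized (applyPerm π w)
normalize w = normalizer 0 (↔-id ℕ) w , λ π → Canonical⇒≤lex π (canonical-normalizer 0 (↔-id ℕ) w) (λ ())

least-witness : ∀ {ℓ} {P : Pred ℕ ℓ} → Decidable P → ∀ n → P n → ∃ λ m → m ≤ n × P m × (∀ {k} → k < m → ¬ P k)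
least-witness P? zero    P0 = 0 , z≤n , P0 , λ ()
least-witness P? (suc n) Pn with P? 0
... | yes P0 = 0 , z≤n , P0 , λ ()
... | no ¬P0 with least-witness (P? ∘ suc) n Pn
... | m , m≤n , Pm , below = suc m , s≤s m≤n , Pm , λ { {zero} _ → ¬P0 ; {suc k} k<m → below (≤-pred k<m) }

-- Γ(w) is the normal form of the longest suffix drop m w of w that is a prefix of a short minimal cube.
IsΓof-exists : ∀ {p} → 1 ≤ p → ∀ w → ∃ (IsΓof p w)
IsΓof-exists {p} 1≤p w with least-witness (λ i → minimalCubePrefix? {p} {drop i w}) (length w) ε-prefix
  where
  ε-prefix : MinimalCubePrefix p (drop (length w) w)
  ε-prefix = subst (MinimalCubePrefix p) (sym (drop-all (length w) w ≤-refl)) (minimalCubePrefix-[] 1≤p)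
... | m , _ , Pm , below with normalize (drop m w)
... | π , normalized = applyPerm π (drop m w) , (normalized , MinimalCubePrefix-applyPerm π Pm) ,
                       (π , drop m w , (take m w , sym (take++drop≡id m w)) , refl) , maximal
  where
  maximal : ∀ g′ → InΓ p g′ → MatchesSuffix g′ w → length g′ ≤ length (applyPerm π (drop m w))
  maximal _ (_ , prefix′) (π′ , s′ , (l , w≡) , refl) = begin
    length (applyPerm π′ s′)        ≡⟨ length-map _ s′ ⟩
    length s′                       ≡⟨ cong length s′≡ ⟩
    length (drop (length l) w)      ≡⟨ length-drop (length l) w ⟩
    length w ∸ length l             ≤⟨ ∸-monoʳ-≤ (length w) m≤l ⟩
    length w ∸ m                    ≡⟨ length-drop m w ⟨
    length (drop m w)               ≡⟨ length-map _ (drop m w) ⟨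
    length (applyPerm π (drop m w)) ∎
    where
    open ≤-Reasoning
    s′≡ : s′ ≡ drop (length l) w
    s′≡ = sym (trans (cong (drop (length l)) w≡) (drop-length-++ l s′))
    m≤l : m ≤ length l
    m≤l = ≮⇒≥ λ l<m → below l<m (subst (MinimalCubePrefix p) s′≡ (MinimalCubePrefix-unapplyPerm π′ prefix′))

-- Periodicity

at : Word → ℕ → Maybe ℕ
at []      _       = nothing
at (c ∷ w) zero    = just c
at (c ∷ w) (suc i) = at w i

at-++ˡ : ∀ u v {i} → i < length u → at (u ++ v) i ≡ at u i
at-++ˡ (c ∷ u) v {zero}  _        = refl
at-++ˡ (c ∷ u) v {suc i} (s≤s i<) = at-++ˡ u v i<

at-++ʳ : ∀ u v i → at (u ++ v) (length u + i) ≡ at v i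
at-++ʳ []      v i = refl
at-++ʳ (c ∷ u) v i = at-++ʳ u v i

at-take : ∀ n w {i} → i < n → at (take n w) i ≡ at w i
at-take (suc n) []      _                = refl
at-take (suc n) (c ∷ w) {zero}  _        = refl
at-take (suc n) (c ∷ w) {suc i} (s≤s i<) = at-take n w i<

at-drop : ∀ n w i → at (drop n w) i ≡ at w (n + i)
at-drop zero    w       i = refl
at-drop (suc n) []      i = refl
at-drop (suc n) (c ∷ w) i = at-drop n w i

at-injective : ∀ {u v} → length u ≡ length v → (∀ i → i < length u → at u i ≡ at v i) → u ≡ v
at-injective {[]}    {[]}    _   _   = refl
at-injective {c ∷ u} {d ∷ v} ∣≡∣ at≡ with at≡ 0 (s≤s z≤n)
... | refl = cong (c ∷_) (at-injective (suc-injective ∣≡∣) (λ i i< → at≡ (suc i) (s≤s i<)))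

Periodic : ℕ → Word → Set
Periodic n w = ∀ i → i + n < length w → at w i ≡ at w (i + n)

periodic-prefix : ∀ {n} w r → Periodic n (w ++ r) → Periodic n w
periodic-prefix {n} w r per i i+n< = begin
  at w i              ≡⟨ at-++ˡ w r (m+n≤o⇒m≤o (suc i) i+n<) ⟨
  at (w ++ r) i       ≡⟨ per i (<-≤-trans i+n< (subst (length w ≤_) (sym (length-++ w)) (m≤m+n _ _))) ⟩
  at (w ++ r) (i + n) ≡⟨ at-++ˡ w r i+n< ⟩
  at w (i + n)        ∎
  where open ≡-Reasoning

periodic-suffix : ∀ {n} l w → Periodic n (l ++ w) → Periodic n w
periodic-suffix {n} l w per i i+n< = begin
  at w i                           ≡⟨ at-++ʳ l w i ⟨
  at (l ++ w) (length l + i)       ≡⟨ per (length l + i) l+i+n< ⟩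
  at (l ++ w) (length l + i + n)   ≡⟨ cong (at (l ++ w)) (+-assoc (length l) i n) ⟩
  at (l ++ w) (length l + (i + n)) ≡⟨ at-++ʳ l w (i + n) ⟩
  at w (i + n)                     ∎
  where
  open ≡-Reasoning
  l+i+n< : length l + i + n < length (l ++ w)
  l+i+n< = subst₂ _<_ (sym (+-assoc (length l) i n)) (sym (length-++ l)) (+-monoʳ-< (length l) i+n<)

periodic-overlap : ∀ {n} l A B r → l ++ B ≡ A ++ r → length l + n ≤ length A →
  Periodic n A → Periodic n B → Periodic n (l ++ B)
periodic-overlap {n} l A B r lB≡Ar l+n≤A perA perB = subst (Periodic n) (sym lB≡Ar) per
  where
  per : Periodic n (A ++ r)
  per i i+n< with i + n <? length A
  ... | yes i+n<A = begin
    at (A ++ r) i       ≡⟨ at-++ˡ A r (m+n≤o⇒m≤o (suc i) i+n<A) ⟩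
    at A i              ≡⟨ perA i i+n<A ⟩
    at A (i + n)        ≡⟨ at-++ˡ A r i+n<A ⟨
    at (A ++ r) (i + n) ∎
    where open ≡-Reasoning
  ... | no i+n≮A = begin
    at (A ++ r) i                    ≡⟨ cong₂ at (sym lB≡Ar) (sym l+j≡i) ⟩
    at (l ++ B) (length l + j)       ≡⟨ at-++ʳ l B j ⟩
    at B j                           ≡⟨ perB j j+n<B ⟩
    at B (j + n)                     ≡⟨ at-++ʳ l B (j + n) ⟨
    at (l ++ B) (length l + (j + n)) ≡⟨ cong₂ at lB≡Ar (trans (sym (+-assoc (length l) j n)) (cong (_+ n) l+j≡i)) ⟩
    at (A ++ r) (i + n)              ∎
    where
    open ≡-Reasoning
    j = i ∸ length l
    l+j≡i : length l + j ≡ i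
    l+j≡i = m+[n∸m]≡n (+-cancelʳ-≤ n (length l) i (≤-trans l+n≤A (≮⇒≥ i+n≮A)))
    j+n<B : j + n < length B
    j+n<B = +-cancelˡ-< (length l) (j + n) (length B) (subst₂ _<_
      (trans (cong (_+ n) (sym l+j≡i)) (+-assoc (length l) j n))
      (trans (cong length (sym lB≡Ar)) (length-++ l)) i+n<)

periodic-square : ∀ x → Periodic (length x) (x ++ x)
periodic-square x i i+x< = begin
  at (x ++ x) i              ≡⟨ at-++ˡ x x i<x ⟩
  at x i                     ≡⟨ at-++ʳ x x i ⟨
  at (x ++ x) (length x + i) ≡⟨ cong (at (x ++ x)) (+-comm (length x) i) ⟩
  at (x ++ x) (i + length x) ∎
  where
  open ≡-Reasoning
  i<x : i < length x
  i<x = +-cancelʳ-< (length x) i (length x) (subst (i + length x <_) (length-++ x) i+x<)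

periodic-cube-of-square : ∀ {n} y → n ≤ length y → Periodic n (y ++ y) → Periodic n (cube y)
periodic-cube-of-square y n≤y per = periodic-overlap y (y ++ y) (y ++ y) y (sym (++-assoc y y y))
  (subst (length y + _ ≤_) (sym (length-++ y)) (+-monoʳ-≤ (length y) n≤y)) per per

periodic-cube : ∀ x → Periodic (length x) (cube x)
periodic-cube x = periodic-cube-of-square x ≤-refl (periodic-square x)

periodic-shift : ∀ {n} w → n + n ≤ length w → Periodic n w → take n (drop n w) ≡ take n w
periodic-shift {n} w 2n≤w per = at-injective (trans ∣take-drop∣ (sym ∣take∣)) at≡
  where
  open ≡-Reasoning
  ∣take∣ : length (take n w) ≡ n
  ∣take∣ = length-take-≤ w (m+n≤o⇒m≤o n 2n≤w)
  ∣take-drop∣ : length (take n (drop n w)) ≡ n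
  ∣take-drop∣ = length-take-≤ (drop n w) (subst (n ≤_) (sym (length-drop n w)) (m+n≤o⇒m≤o∸n n 2n≤w))
  at≡ : ∀ i → i < length (take n (drop n w)) → at (take n (drop n w)) i ≡ at (take n w) i
  at≡ i i<take = begin
    at (take n (drop n w)) i ≡⟨ at-take n (drop n w) i<n ⟩
    at (drop n w) i          ≡⟨ at-drop n w i ⟩
    at w (n + i)             ≡⟨ cong (at w) (+-comm n i) ⟩
    at w (i + n)             ≡⟨ per i (<-≤-trans (+-monoˡ-< n i<n) 2n≤w) ⟨
    at w i                   ≡⟨ at-take n w i<n ⟨
    at (take n w) i          ∎
    where
    i<n : i < n
    i<n = subst (i <_) ∣take-drop∣ i<take

periodic⇒cube-prefix : ∀ {n} w → n + (n + n) ≤ length w → Periodic n w →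
  ∃[ t ] (length t ≡ n × ∃[ r ] w ≡ cube t ++ r)
periodic⇒cube-prefix {n} w 3n≤w per = t , length-take-≤ w (m+n≤o⇒m≤o n 3n≤w) , drop n w₂ , (begin
  w                                ≡⟨ take++drop≡id n w ⟨
  t ++ w₁                          ≡⟨ cong (t ++_) (take++drop≡id n w₁) ⟨
  t ++ take n w₁ ++ w₂             ≡⟨ cong (λ z → t ++ z ++ w₂) t₁≡t ⟩
  t ++ t ++ w₂                     ≡⟨ cong (λ z → t ++ t ++ z) (take++drop≡id n w₂) ⟨
  t ++ t ++ take n w₂ ++ drop n w₂ ≡⟨ cong (λ z → t ++ t ++ z ++ drop n w₂) (trans t₂≡t₁ t₁≡t) ⟩
  t ++ t ++ t ++ drop n w₂         ≡⟨ cube-++ t (drop n w₂) ⟨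
  cube t ++ drop n w₂              ∎)
  where
  open ≡-Reasoning
  t = take n w
  w₁ = drop n w
  w₂ = drop n w₁
  2n≤w₁ : n + n ≤ length w₁
  2n≤w₁ = subst (n + n ≤_) (sym (length-drop n w))
            (m+n≤o⇒m≤o∸n (n + n) (subst (_≤ length w) (+-comm n (n + n)) 3n≤w))
  t₁≡t : take n w₁ ≡ t
  t₁≡t = periodic-shift w (≤-trans (m≤n+m (n + n) n) 3n≤w) per
  t₂≡t₁ : take n w₂ ≡ take n w₁
  t₂≡t₁ = periodic-shift w₁ 2n≤w₁ (periodic-suffix t w₁ (subst (Periodic n) (sym (take++drop≡id n w)) per))

square-suffix⇒¬MinimalCubePrefix : ∀ {p} y {s} → NonEmpty y → InCtilde p (cube y) →
  Suffix (y ++ y) s → ¬ MinimalCubePrefix p s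
square-suffix⇒¬MinimalCubePrefix {p} y {s} y≢ε yyy∈C (l , s≡) prefix with MinimalCubePrefix⇒root prefix
... | x , x≢ε , x≤p , _ , r , _ , cube≡ with periodic⇒cube-prefix (cube y) 3x≤3y per-yyy
  where
  p<y : p < length y
  p<y = ≰⇒> λ y≤p → yyy∈C y y≢ε y≤p ([] , [] , sym (++-identityʳ _))
  x≤y : length x ≤ length y
  x≤y = <⇒≤ (≤-<-trans x≤p p<y)
  per-yyy : Periodic (length x) (cube y)
  per-yyy = periodic-cube-of-square y x≤y (periodic-suffix l (y ++ y) (subst (Periodic _) s≡
              (periodic-prefix s r (subst (Periodic _) cube≡ (periodic-cube x)))))
  3x≤3y : length x + (length x + length x) ≤ length (cube y)
  3x≤3y = subst (_ ≤_) (sym (length-cube y)) (+-mono-≤ x≤y (+-mono-≤ x≤y x≤y))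
... | t , ∣t∣ , r′ , yyy≡ = yyy∈C t (subst (1 ≤_) (sym ∣t∣) x≢ε) (subst (_≤ p) (sym ∣t∣) x≤p) ([] , r′ , yyy≡)

IsΓof-extendˡ : ∀ {p} X y {g} → NonEmpty y → InCtilde p (cube y) → IsΓof p (y ++ y) g → IsΓof p (X ++ y ++ y) g
IsΓof-extendˡ {p} X y {g} y≢ε yyy∈C (inΓ , (π , s , (l , yy≡) , g≡) , maximal) =
  inΓ , (π , s , (X ++ l , trans (cong (X ++_) yy≡) (sym (++-assoc X l s))) , g≡) , maximal′
  where
  maximal′ : ∀ g′ → InΓ p g′ → MatchesSuffix g′ (X ++ y ++ y) → length g′ ≤ length g
  maximal′ g′ inΓ′@(_ , prefix′) (π′ , s′ , (l′ , w≡) , refl) with length s′ ≤? length (y ++ y)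
  ... | yes short = maximal g′ inΓ′ (π′ , s′ , Suffix-of-shorter X l′ (y ++ y) s′ w≡ short , refl)
  ... | no  long  = ⊥-elim (square-suffix⇒¬MinimalCubePrefix y y≢ε yyy∈C
                      (Suffix-of-shorter l′ X s′ (y ++ y) (sym w≡) (<⇒≤ (≰⇒> long)))
                      (MinimalCubePrefix-unapplyPerm π′ prefix′))

corollary1 : (v : Word) (a : ℕ) (u y : Word)
    → CubeFree v
    → InCtilde 12 (v ++ a ∷ [])
    → NonEmpty u → NonEmpty y
    → v ++ a ∷ [] ≡ u ++ y ++ y ++ y
    → ∃[ g ] (IsΓof 12 (v ++ a ∷ []) g × IsΓof 12 (y ++ y) g × IsΓof 12 (u ++ y ++ y) g)
corollary1 v a u y _ va∈C _ y≢ε va≡ with IsΓof-exists (s≤s z≤n) (y ++ y)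
... | g , Γyy = g , subst (λ w → IsΓof 12 w g) (sym va≡′) (IsΓof-extendˡ (u ++ y) y y≢ε yyy∈C Γyy) ,
                Γyy , IsΓof-extendˡ u y y≢ε yyy∈C Γyy
  where
  va≡′ : v ++ a ∷ [] ≡ (u ++ y) ++ y ++ y
  va≡′ = trans va≡ (sym (++-assoc u y (y ++ y)))
  yyy∈C : InCtilde 12 (cube y)
  yyy∈C t t≢ε t≤12 fac = va∈C t t≢ε t≤12 (subst (Factor _) (sym va≡) (Factor-++ˡ u fac))
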